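{- If $D$ is a digraph whose underlying graph is a tree, then ${\rm ndi}(D)\le\Delta^*(D)+1$.
   Context: All digraphs are finite, without loops and without multiple arcs (opposite arcs allowed). The underlying graph of $D$ is the simple undirected graph obtained by replacing each arc $uv$ (or each pair of arcs $uv,vu$) by the edge $uv$. $\Delta^*(D)$ is the maximum of the maximum outdegree and the maximum indegree of $D$. A (proper) $k$-arc-colouring of $D$ is a map $\gamma$ from $A(D)$ to a set of $k$ colours such that arcs with the same head get distinct colours and arcs with the same tail get distinct colours. $S_\gamma^+(u)$, $S_\gamma^-(u)$ are the sets of colours on arcs with tail $u$, resp. head $u$. $\gamma$ is neighbour-distinguishing if for every arc $uv$, $(S_\gamma^+(u),S_\gamma^-(u))\neq(S_\gamma^+(v),S_\gamma^-(v))$ as ordered pairs. ${\rm ndi}(D)$ is the minimum number of colours of a neighbour-distinguishing arc-colouring of $D$. -}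

module Defs where

open import Data.Nat using (ℕ; _⊔_; _+_; _≤_)
open import Data.Bool using (Bool; true; false; _∨_; T; if_then_else_)
open import Data.Fin using (Fin)
open import Data.List using (List; []; _∷_; length; map; foldr; allFin; _∷ʳ_)
open import Data.Nat.ListAction using (sum)
open import Data.List.Relation.Unary.Unique.Propositional using (Unique)
open import Data.List.Relation.Unary.Linked using (Linked)
open import Data.Product using (Σ; ∃; _×_)
open import Relation.Binary.PropositionalEquality using (_≡_; _≢_)
open import Relation.Binary.Construct.Closure.ReflexiveTransitive using (Star)
open import Relation.Nullary using (¬_)

-- A digraph on vertex set Fin n: an arc relation given by a Boolean
-- adjacency function, with no loops.  Opposite arcs are allowed; multiple
-- arcs are impossible by construction.
record Digraph (n : ℕ) : Set where
  field
    arc    : Fin n → Fin n → Bool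
    noLoop : ∀ u → arc u u ≡ false
open Digraph public

module _ {n : ℕ} (D : Digraph n) where

  Arc : Fin n → Fin n → Set
  Arc u v = T (arc D u v)

  Adj : Fin n → Fin n → Set
  Adj u v = T (arc D u v ∨ arc D v u)

  Connected : Set
  Connected = ∀ u v → Star Adj u v

  IsCycle : Fin n → List (Fin n) → Set
  IsCycle x xs = 2 ≤ length xs × Unique (x ∷ xs) × Linked Adj ((x ∷ xs) ∷ʳ x)

  Acyclic : Set
  Acyclic = ∀ x xs → ¬ IsCycle x xs

  UnderlyingTree : Set
  UnderlyingTree = Connected × Acyclic

  outdeg indeg : Fin n → ℕ
  outdeg u = sum (map (λ v → if arc D u v then 1 else 0) (allFin n))
  indeg  u = sum (map (λ v → if arc D v u then 1 else 0) (allFin n))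

  Δ* : ℕ
  Δ* = foldr _⊔_ 0 (map (λ u → outdeg u ⊔ indeg u) (allFin n))

  ArcColouring : ℕ → Set
  ArcColouring k = (u v : Fin n) → Arc u v → Fin k

  module _ {k : ℕ} (γ : ArcColouring k) where

    Proper : Set
    Proper = (∀ u v w (p : Arc u v) (q : Arc u w) → v ≢ w → γ u v p ≢ γ u w q)
           × (∀ u v w (p : Arc u w) (q : Arc v w) → u ≢ v → γ u w p ≢ γ v w q)

    InS⁺ : Fin n → Fin k → Set
    InS⁺ u c = Σ (Fin n) λ v → Σ (Arc u v) λ p → γ u v p ≡ c

    InS⁻ : Fin n → Fin k → Set
    InS⁻ u c = Σ (Fin n) λ v → Σ (Arc v u) λ p → γ v u p ≡ c

    SameSet : (Fin n → Fin k → Set) → Fin n → Fin n → Set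
    SameSet S u v = ∀ c → (S u c → S v c) × (S v c → S u c)

    NeighbourDistinguishing : Set
    NeighbourDistinguishing =
      ∀ u v → Arc u v → ¬ (SameSet InS⁺ u v × SameSet InS⁻ u v)

  HasNDColouring : ℕ → Set
  HasNDColouring k = Σ (ArcColouring k) λ γ → Proper γ × NeighbourDistinguishing γ

  -- ndi(D) ≤ m  (ndi is the least k admitting such a colouring)
  ndi≤ : ℕ → Set
  ndi≤ m = Σ ℕ λ k → k ≤ m × HasNDColouring k

module Submission where

-- We maintain a stronger invariant than neighbour-distinction: a proper
-- (K+1)-arc-colouring γ together with a "parent certificate", which orients
-- every edge of the underlying graph from a child to its parent (each vertex
-- has at most one parent) and, for every child c of p, exhibits an arc between
-- c and p whose colour separates them: either p→c with γ(pc) ∉ S⁺(c), or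
-- c→p with γ(cp) ∉ S⁻(c).  Such a certificate implies neighbour-distinction
-- (certificate⇒nd).
--
-- For every digraph whose underlying graph is a forest a certified colouring is built by induction on the number of arcs: a
-- forest with an arc has a pendant vertex v with unique neighbour u (found along
-- a maximal simple path); colour D without the arcs at v by induction, then give the at most two arcs
-- between u and v colours that avoid the other arcs at u, differ from each
-- other, and keep u separated from its own parent.  The degree bound K leaves
-- room for these choices (pickTwo).

open import Data.Nat using (ℕ; zero; suc; _+_; _≤_; _<_; _⊔_; z≤n; s≤s)
open import Data.Nat.Properties
  using (≤-refl; ≤-trans; <⇒≤; <⇒≱; +-mono-≤; +-mono-<-≤; +-mono-≤-<; +-suc; +-identityʳ;
         n≤1+n; m≤m⊔n; m≤n⊔m; module ≤-Reasoning)
open import Data.Nat.Induction using (<-wellFounded)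
open import Data.Nat.ListAction using (sum)
open import Data.Bool using (Bool; true; false; T; if_then_else_; _∧_; _∨_)
open import Data.Bool.Properties using (T-∧; T-∨; T-irrelevant)
open import Data.Fin using (Fin; zero; suc; _≟_)
open import Data.Fin.Properties using (any?; injective⇒≤)
open import Data.List using (List; []; _∷_; length; map; foldr; allFin; lookup; take; _∷ʳ_)
open import Data.List.Relation.Unary.Any using (here; there; index)
import Data.List.Relation.Unary.Any as Any
open import Data.List.Relation.Unary.All as All using ([]; _∷_)
open import Data.List.Relation.Unary.All.Properties using (¬Any⇒All¬)
open import Data.List.Membership.Propositional using (_∈_; _∉_)
open import Data.List.Membership.Propositional.Properties using (∈-allFin; ∈-lookup; ∈-map⁺)
open import Data.List.Membership.Setoid.Properties using (index-injective)
open import Data.List.Relation.Unary.Unique.Propositional using (Unique; []; _∷_)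
open import Data.List.Relation.Unary.Unique.Propositional.Properties using (take⁺)
open import Data.List.Relation.Unary.Linked using (Linked; [-]; _∷_)
import Data.List.Relation.Unary.Linked as Linked
open import Data.Maybe using (Maybe; just; nothing)
open import Data.Product using (∃; _×_; _,_; proj₁; proj₂; map₂; swap)
open import Data.Sum using (_⊎_; inj₁; inj₂)
import Data.Sum as Sum
open import Data.Unit using (⊤; tt)
open import Data.Empty using (⊥-elim)
open import Function using (_∘_)
open import Function.Bundles using (Equivalence)
open import Induction.WellFounded using (Acc; acc)
open import Relation.Nullary using (¬_; Dec; yes; no; contradiction)
open import Relation.Nullary.Decidable
  using (¬?; _×-dec_; decidable-stable; T?; isNo; toWitnessFalse; fromWitnessFalse)
open import Relation.Binary.PropositionalEquality
  using (_≡_; _≢_; refl; sym; trans; cong; subst; subst₂; setoid; module ≡-Reasoning)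
open import Defs

open Equivalence using (to; from)

_∈?_ : ∀ {m} (c : Fin m) (L : List (Fin m)) → Dec (c ∈ L)
c ∈? L = Any.any? (c ≟_) L

-- Pigeonhole: a list of at most K colours misses one of the K+1 colours,
-- since otherwise positions in the list would encode Fin (suc K) injectively.
freshColour : ∀ {K} (L : List (Fin (suc K))) → length L ≤ K → ∃ λ c → c ∉ L
freshColour {K} L |L|≤K with any? (λ c → ¬? (c ∈? L))
... | yes found = found
... | no noneMissing = contradiction (injective⇒≤ position-injective) (<⇒≱ (s≤s |L|≤K))
  where
  everywhere : ∀ c → c ∈ L
  everywhere c = decidable-stable (c ∈? L) (λ c∉L → noneMissing (c , c∉L))
  position-injective : ∀ {c d} → index (everywhere c) ≡ index (everywhere d) → c ≡ d
  position-injective = index-injective (setoid _) (everywhere _) (everywhere _)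

avoid : ∀ {K} {P : Set} → Dec P → (L : List (Fin (suc K))) → (P → length L ≤ K) →
        ∃ λ c → P → c ∉ L
avoid (yes p) L bound = map₂ (λ c∉L _ → c∉L) (freshColour L (bound p))
avoid (no ¬p) L _     = zero , λ p → contradiction p ¬p

data Requirement (C : Set) : Set where
  free       : Requirement C
  avoidOnOut : C → Requirement C
  avoidOnIn  : C → Requirement C

Respects : {C : Set} (PA PB : Set) → Requirement C → C → C → Set
Respects PA PB free           a b = ⊤
Respects PA PB (avoidOnOut c) a b = PA → a ≢ c
Respects PA PB (avoidOnIn c)  a b = PB → b ≢ c

record ColourPair {K : ℕ} (PA PB : Set) (LA LB : List (Fin (suc K)))
                  (e : Requirement (Fin (suc K))) : Set where
  field
    colA colB : Fin (suc K)
    colA∉     : PA → colA ∉ LA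
    colB∉     : PB → colB ∉ LB
    colA≢colB : PA → PB → colA ≢ colB
    respects  : Respects PA PB e colA colB

-- Each list leaves room for one more colour, so it suffices to choose first
-- the colour carrying the extra requirement, then the other one avoiding it.
pickTwo : ∀ {K} {PA PB : Set} → Dec PA → Dec PB → (LA LB : List (Fin (suc K)))
          (e : Requirement (Fin (suc K))) →
          (PA → suc (length LA) ≤ K) → (PB → suc (length LB) ≤ K) → ColourPair PA PB LA LB e
pickTwo dA dB LA LB (avoidOnOut c) roomA roomB
  with a , a∉ ← avoid dA (c ∷ LA) roomA
  with b , b∉ ← avoid dB (a ∷ LB) roomB = record
  { colA = a ; colB = b
  ; colA∉ = λ pa → a∉ pa ∘ there ; colB∉ = λ pb → b∉ pb ∘ there
  ; colA≢colB = λ _ pb a≡b → b∉ pb (here (sym a≡b))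
  ; respects = λ pa → a∉ pa ∘ here }
pickTwo dA dB LA LB (avoidOnIn c) roomA roomB
  with b , b∉ ← avoid dB (c ∷ LB) roomB
  with a , a∉ ← avoid dA (b ∷ LA) roomA = record
  { colA = a ; colB = b
  ; colA∉ = λ pa → a∉ pa ∘ there ; colB∉ = λ pb → b∉ pb ∘ there
  ; colA≢colB = λ pa _ → a∉ pa ∘ here
  ; respects = λ pb → b∉ pb ∘ here }
pickTwo dA dB LA LB free roomA roomB
  with b , b∉ ← avoid dB LB (<⇒≤ ∘ roomB)
  with a , a∉ ← avoid dA (b ∷ LA) roomA = record
  { colA = a ; colB = b
  ; colA∉ = λ pa → a∉ pa ∘ there ; colB∉ = b∉
  ; colA≢colB = λ pa _ → a∉ pa ∘ here
  ; respects = tt }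

sum-mono : ∀ {A : Set} (xs : List A) {f g : A → ℕ} → (∀ x → f x ≤ g x) →
           sum (map f xs) ≤ sum (map g xs)
sum-mono []       f≤g = z≤n
sum-mono (x ∷ xs) f≤g = +-mono-≤ (f≤g x) (sum-mono xs f≤g)

sum-strict : ∀ {A : Set} (xs : List A) {f g : A → ℕ} → (∀ x → f x ≤ g x) →
             ∀ {y} → y ∈ xs → f y < g y → sum (map f xs) < sum (map g xs)
sum-strict (x ∷ xs) f≤g (here refl) fy<gy = +-mono-<-≤ fy<gy (sum-mono xs f≤g)
sum-strict (x ∷ xs) f≤g (there y∈xs) fy<gy = +-mono-≤-< (f≤g x) (sum-strict xs f≤g y∈xs fy<gy)

count : {X : Set} → (X → Bool) → List X → ℕ
count R xs = sum (map (λ x → if R x then 1 else 0) xs)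

indicator-mono : (b b′ : Bool) → (T b′ → T b) → (if b′ then 1 else 0) ≤ (if b then 1 else 0)
indicator-mono b     false _    = z≤n
indicator-mono true  true  _    = ≤-refl
indicator-mono false true  b′⇒b = ⊥-elim (b′⇒b _)

indicator-strict : (b b′ : Bool) → ¬ T b′ → T b → (if b′ then 1 else 0) < (if b then 1 else 0)
indicator-strict true false _  _ = s≤s z≤n
indicator-strict _    true  ¬b′ _ = ⊥-elim (¬b′ _)

count-mono : {X : Set} {R R′ : X → Bool} (xs : List X) → (∀ x → T (R′ x) → T (R x)) →
             count R′ xs ≤ count R xs
count-mono {R = R} {R′} xs R′⇒R = sum-mono xs (λ x → indicator-mono (R x) (R′ x) (R′⇒R x))

count-strict : {X : Set} {R R′ : X → Bool} (xs : List X) → (∀ x → T (R′ x) → T (R x)) →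
               ∀ {y} → y ∈ xs → ¬ T (R′ y) → T (R y) → count R′ xs < count R xs
count-strict {R = R} {R′} xs R′⇒R {y} y∈xs ¬R′y Ry =
  sum-strict xs (λ x → indicator-mono (R x) (R′ x) (R′⇒R x)) y∈xs (indicator-strict (R y) (R′ y) ¬R′y Ry)

collect : {X A : Set} (R : X → Bool) → (∀ x → T (R x) → A) → List X → List A
collect R g []       = []
collect R g (x ∷ xs) with R x | g x
... | true  | gx = gx tt ∷ collect R g xs
... | false | _  = collect R g xs

length-collect : {X A : Set} (R : X → Bool) (g : ∀ x → T (R x) → A) (xs : List X) →
                 length (collect R g xs) ≡ count R xs
length-collect R g []       = refl
length-collect R g (x ∷ xs) with R x | g x
... | true  | _ = cong suc (length-collect R g xs)
... | false | _ = length-collect R g xs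

∈-collect : {X A : Set} (R : X → Bool) (g : ∀ x → T (R x) → A) {x : X} (xs : List X) →
            x ∈ xs → (r : T (R x)) → g x r ∈ collect R g xs
∈-collect R g (x ∷ xs) (here refl) r with R x | g x
... | true  | gx = here refl
∈-collect R g (y ∷ xs) (there x∈xs) r with R y | g y
... | true  | _ = there (∈-collect R g xs x∈xs r)
... | false | _ = ∈-collect R g xs x∈xs r

≤-maximum : ∀ {x} (xs : List ℕ) → x ∈ xs → x ≤ foldr _⊔_ 0 xs
≤-maximum (y ∷ ys) (here refl)  = m≤m⊔n y _
≤-maximum (y ∷ ys) (there x∈ys) = ≤-trans (≤-maximum ys x∈ys) (m≤n⊔m y _)

-- Distinct elements of Fin n occupy distinct positions, so there are at most n.
lookup-injective : ∀ {A : Set} {xs : List A} → Unique xs → ∀ {i j} → lookup xs i ≡ lookup xs j → i ≡ j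
lookup-injective {xs = x ∷ xs} (_ ∷ _)   {zero}  {zero}  _ = refl
lookup-injective {xs = x ∷ xs} (x∉ ∷ _)  {zero}  {suc j} e = ⊥-elim (All.lookup x∉ (∈-lookup j) e)
lookup-injective {xs = x ∷ xs} (x∉ ∷ _)  {suc i} {zero}  e = ⊥-elim (All.lookup x∉ (∈-lookup i) (sym e))
lookup-injective {xs = x ∷ xs} (_ ∷ uniq) {suc i} {suc j} e = cong suc (lookup-injective uniq e)

unique-length≤ : ∀ {n} {xs : List (Fin n)} → Unique xs → length xs ≤ n
unique-length≤ uniq = injective⇒≤ (lookup-injective uniq)

module _ {n : ℕ} (D : Digraph n) where

  adj-cases : ∀ {a b} → Adj D a b → Arc D a b ⊎ Arc D b a
  adj-cases = to T-∨

  arc⇒adj : ∀ {a b} → Arc D a b → Adj D a b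
  arc⇒adj ab = from T-∨ (inj₁ ab)

  adj-sym : ∀ {a b} → Adj D a b → Adj D b a
  adj-sym a~b = from T-∨ (Sum.swap (adj-cases a~b))

  ¬adj-self : ∀ a → ¬ Adj D a a
  ¬adj-self a a~a = Sum.[ loop , loop ] (adj-cases a~a)
    where
    loop : ¬ Arc D a a
    loop = subst T (noLoop D a)

  outdeg≤Δ* : ∀ a → outdeg D a ≤ Δ* D
  outdeg≤Δ* a = ≤-trans (m≤m⊔n _ _) (≤-maximum _ (∈-map⁺ (λ x → outdeg D x ⊔ indeg D x) (∈-allFin a)))

  indeg≤Δ* : ∀ a → indeg D a ≤ Δ* D
  indeg≤Δ* a = ≤-trans (m≤n⊔m _ _) (≤-maximum _ (∈-map⁺ (λ x → outdeg D x ⊔ indeg D x) (∈-allFin a)))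

  -- total number of arcs, the measure of the induction
  arcCount : ℕ
  arcCount = sum (map (outdeg D) (allFin n))

  module _ {k : ℕ} (γ : ArcColouring D k) where

    outColours inColours : Fin n → List (Fin k)
    outColours u = collect (arc D u) (γ u) (allFin n)
    inColours  u = collect (λ w → arc D w u) (λ w → γ w u) (allFin n)

    length-outColours : ∀ u → length (outColours u) ≡ outdeg D u
    length-outColours u = length-collect (arc D u) (γ u) (allFin n)

    length-inColours : ∀ u → length (inColours u) ≡ indeg D u
    length-inColours u = length-collect (λ w → arc D w u) (λ w → γ w u) (allFin n)

    ∈-outColours : ∀ {u w} (uw : Arc D u w) → γ u w uw ∈ outColours u
    ∈-outColours {u} {w} uw = ∈-collect (arc D u) (γ u) (allFin n) (∈-allFin w) uw

    ∈-inColours : ∀ {u w} (wu : Arc D w u) → γ w u wu ∈ inColours u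
    ∈-inColours {u} {w} wu = ∈-collect (λ x → arc D x u) (λ x → γ x u) (allFin n) (∈-allFin w) wu

_⊑_ : ∀ {n} → Digraph n → Digraph n → Set
D′ ⊑ D = ∀ {a b} → Arc D′ a b → Arc D a b

module _ {n : ℕ} {D′ D : Digraph n} (D′⊑D : D′ ⊑ D) where

  adj-⊑ : ∀ {a b} → Adj D′ a b → Adj D a b
  adj-⊑ a~b = from T-∨ (Sum.map D′⊑D D′⊑D (adj-cases D′ a~b))

  acyclic-⊑ : Acyclic D → Acyclic D′
  acyclic-⊑ acyclic x xs (long , uniq , linked) = acyclic x xs (long , uniq , Linked.map adj-⊑ linked)

  outdeg-⊑ : ∀ a → outdeg D′ a ≤ outdeg D a
  outdeg-⊑ a = count-mono (allFin n) (λ _ → D′⊑D)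

  indeg-⊑ : ∀ a → indeg D′ a ≤ indeg D a
  indeg-⊑ a = count-mono (allFin n) (λ _ → D′⊑D)

  outdeg-⊏ : ∀ {a b} → Arc D a b → ¬ Arc D′ a b → outdeg D′ a < outdeg D a
  outdeg-⊏ {b = b} ab ¬ab′ = count-strict (allFin n) (λ _ → D′⊑D) (∈-allFin b) ¬ab′ ab

  indeg-⊏ : ∀ {a b} → Arc D a b → ¬ Arc D′ a b → indeg D′ b < indeg D b
  indeg-⊏ {a = a} ab ¬ab′ = count-strict (allFin n) (λ _ → D′⊑D) (∈-allFin a) ¬ab′ ab

  arcCount-⊏ : ∀ {a b} → Arc D a b → ¬ Arc D′ a b → arcCount D′ < arcCount D
  arcCount-⊏ {a} ab ¬ab′ = sum-strict (allFin n) outdeg-⊑ (∈-allFin a) (outdeg-⊏ ab ¬ab′)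

-- D with all arcs at v removed (v remains, isolated)
delete : ∀ {n} → Digraph n → Fin n → Digraph n
delete D v = record
  { arc    = λ a b → arc D a b ∧ isNo (a ≟ v) ∧ isNo (b ≟ v)
  ; noLoop = λ a → cong (_∧ _) (noLoop D a) }

module Deletion {n : ℕ} (D : Digraph n) (v : Fin n) where

  delete-⊑ : delete D v ⊑ D
  delete-⊑ {a} {b} = proj₁ ∘ to (T-∧ {arc D a b})

  kept⇒≢ : ∀ {a b} → Arc (delete D v) a b → a ≢ v × b ≢ v
  kept⇒≢ {a} {b} ab′ =
    let ends = to (T-∧ {isNo (a ≟ v)}) (proj₂ (to (T-∧ {arc D a b}) ab′)) in
    toWitnessFalse {a? = a ≟ v} (proj₁ ends) , toWitnessFalse {a? = b ≟ v} (proj₂ ends)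

  arc⇒kept : ∀ {a b} → Arc D a b → a ≢ v → b ≢ v → Arc (delete D v) a b
  arc⇒kept {a} {b} ab a≢v b≢v =
    from (T-∧ {arc D a b}) (ab , from (T-∧ {isNo (a ≟ v)})
      (fromWitnessFalse {a? = a ≟ v} a≢v , fromWitnessFalse {a? = b ≟ v} b≢v))

  adj⇒kept : ∀ {a b} → Adj D a b → a ≢ v → b ≢ v → Adj (delete D v) a b
  adj⇒kept a~b a≢v b≢v with adj-cases D a~b
  ... | inj₁ ab = arc⇒adj (delete D v) (arc⇒kept ab a≢v b≢v)
  ... | inj₂ ba = adj-sym (delete D v) (arc⇒adj (delete D v) (arc⇒kept ba b≢v a≢v))

  acyclic-delete : Acyclic D → Acyclic (delete D v)
  acyclic-delete = acyclic-⊑ {D′ = delete D v} {D} delete-⊑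

  outdeg-delete-≤ : ∀ a → outdeg (delete D v) a ≤ outdeg D a
  outdeg-delete-≤ = outdeg-⊑ {D′ = delete D v} {D} delete-⊑

  indeg-delete-≤ : ∀ a → indeg (delete D v) a ≤ indeg D a
  indeg-delete-≤ = indeg-⊑ {D′ = delete D v} {D} delete-⊑

  outdeg-delete : ∀ {a} → Arc D a v → outdeg (delete D v) a < outdeg D a
  outdeg-delete av = outdeg-⊏ {D′ = delete D v} {D} delete-⊑ av (λ av′ → proj₂ (kept⇒≢ av′) refl)

  indeg-delete : ∀ {a} → Arc D v a → indeg (delete D v) a < indeg D a
  indeg-delete va = indeg-⊏ {D′ = delete D v} {D} delete-⊑ va (λ va′ → proj₁ (kept⇒≢ va′) refl)

  arcCount-delete : ∀ {u} → Adj D v u → arcCount (delete D v) < arcCount D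
  arcCount-delete v~u with adj-cases D v~u
  ... | inj₁ vu = arcCount-⊏ {D′ = delete D v} {D} delete-⊑ vu (λ vu′ → proj₁ (kept⇒≢ vu′) refl)
  ... | inj₂ uv = arcCount-⊏ {D′ = delete D v} {D} delete-⊑ uv (λ uv′ → proj₂ (kept⇒≢ uv′) refl)

module _ {n : ℕ} (D : Digraph n) where

  record PendantVertex : Set where
    field
      vertex neighbour : Fin n
      adjacent         : Adj D vertex neighbour
      onlyNeighbour    : ∀ w → Adj D vertex w → w ≡ neighbour

  -- A path y ∷ ys meeting a neighbour w of x is closed into a cycle through
  -- x by the initial segment y ∷ take i ys ending at w.
  closePath : ∀ {x w} y ys → Linked (Adj D) (y ∷ ys) → w ∈ ys → Adj D w x →
              ∃ λ i → 1 ≤ length (take i ys) × Linked (Adj D) ((y ∷ take i ys) ∷ʳ x)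
  closePath y (w ∷ ys) (y~w ∷ _) (here refl) w~x = 1 , s≤s z≤n , y~w ∷ w~x ∷ [-]
  closePath y (z ∷ ys) (y~z ∷ path) (there w∈ys) w~x =
    let (i , long , closed) = closePath z ys path w∈ys w~x in suc i , s≤s z≤n , y~z ∷ closed

  module _ (acyclic : Acyclic D) where

    -- Extend the simple path x ∷ y ∷ ys at its end x while x has a neighbour
    -- off the path.  The path has at most n vertices, so fuel suffices; when
    -- stuck, a neighbour of x other than y would close a cycle, so x is pendant.
    walk : (fuel : ℕ) (x y : Fin n) (ys : List (Fin n)) → Unique (x ∷ y ∷ ys) →
           Linked (Adj D) (x ∷ y ∷ ys) → n < length (x ∷ y ∷ ys) + fuel → PendantVertex
    walk zero x y ys uniq path bound =
      contradiction (unique-length≤ uniq) (<⇒≱ (subst (n <_) (+-identityʳ _) bound))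
    walk (suc fuel) x y ys uniq path bound
      with any? (λ w → T? (arc D x w ∨ arc D w x) ×-dec ¬? (w ∈? (x ∷ y ∷ ys)))
    ... | yes (w , x~w , w∉path) =
      walk fuel w x (y ∷ ys) (¬Any⇒All¬ _ w∉path ∷ uniq) (adj-sym D x~w ∷ path)
           (subst (n <_) (+-suc _ fuel) bound)
    ... | no stuck = record { vertex = x ; neighbour = y ; adjacent = Linked.head path
                            ; onlyNeighbour = only }
      where
      only : ∀ w → Adj D x w → w ≡ y
      only w x~w with decidable-stable (w ∈? (x ∷ y ∷ ys)) (λ w∉path → stuck (w , x~w , w∉path))
      ... | here refl = ⊥-elim (¬adj-self D x x~w)
      ... | there (here w≡y) = w≡y
      ... | there (there w∈ys) =
        let (i , long , closed) = closePath y ys (Linked.tail path) w∈ys (adj-sym D x~w) in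
        ⊥-elim (acyclic x (y ∷ take i ys) (s≤s long , take⁺ (2 + i) uniq , Linked.head path ∷ closed))

    pendantVertex : ∀ {a b} → Arc D a b → PendantVertex
    pendantVertex {a} {b} ab = walk n b a [] ((b≢a ∷ []) ∷ [] ∷ []) (adj-sym D (arc⇒adj D ab) ∷ [-])
                                    (s≤s (n≤1+n n))
      where
      b≢a : b ≢ a
      b≢a b≡a = ¬adj-self D a (subst (Adj D a) b≡a (arc⇒adj D ab))

module _ {n : ℕ} (D : Digraph n) {k : ℕ} (γ : ArcColouring D k) where

  -- c is told apart from p by the colour of an arc between them: that colour
  -- lies in S⁺(p) but not S⁺(c), or in S⁻(p) but not S⁻(c).
  data Distinguished (c p : Fin n) : Set where
    viaOut : (pc : Arc D p c) → (∀ w (cw : Arc D c w) → γ c w cw ≢ γ p c pc) → Distinguished c p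
    viaIn  : (cp : Arc D c p) → (∀ w (wc : Arc D w c) → γ w c wc ≢ γ c p cp) → Distinguished c p

  DistinguishedFrom : Fin n → Maybe (Fin n) → Set
  DistinguishedFrom c nothing  = ⊤
  DistinguishedFrom c (just p) = Distinguished c p

  record ParentCertificate : Set where
    field
      parent            : Fin n → Maybe (Fin n)
      fromParent        : ∀ c → DistinguishedFrom c (parent c)
      edgeToParent      : ∀ a b → Adj D a b → parent a ≡ just b ⊎ parent b ≡ just a

  distinguished⇒differ : ∀ {c p} → Distinguished c p → ¬ (SameSet D γ (InS⁺ D γ) c p × SameSet D γ (InS⁻ D γ) c p)
  distinguished⇒differ {c} {p} (viaOut pc fresh) (same⁺ , _) =
    let (w , cw , colour≡) = proj₂ (same⁺ (γ p c pc)) (c , pc , refl) in fresh w cw colour≡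
  distinguished⇒differ {c} {p} (viaIn cp fresh) (_ , same⁻) =
    let (w , wc , colour≡) = proj₂ (same⁻ (γ c p cp)) (c , cp , refl) in fresh w wc colour≡

  certificate⇒nd : ParentCertificate → NeighbourDistinguishing D γ
  certificate⇒nd cert a b ab (same⁺ , same⁻) =
    Sum.[ (λ a↑b → distinguished⇒differ (certified a↑b) (same⁺ , same⁻))
        , (λ b↑a → distinguished⇒differ (certified b↑a) (flip same⁺ , flip same⁻)) ]
      (edgeToParent a b (arc⇒adj D ab))
    where
    open ParentCertificate cert
    certified : ∀ {c p} → parent c ≡ just p → Distinguished c p
    certified {c} c↑p = subst (DistinguishedFrom c) c↑p (fromParent c)
    flip : ∀ {S} → SameSet D γ S a b → SameSet D γ S b a
    flip same c = swap (same c)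

record GoodColouring {n : ℕ} (D : Digraph n) (k : ℕ) : Set where
  field
    colour      : ArcColouring D k
    proper      : Proper D colour
    certificate : ParentCertificate D colour

arclessColouring : ∀ {n} (D : Digraph n) {k} → (∀ a b → ¬ Arc D a b) → GoodColouring D k
arclessColouring D noArc = record
  { colour = λ a b ab → ⊥-elim (noArc a b ab)
  ; proper = (λ a b _ ab → ⊥-elim (noArc a b ab)) , (λ a _ c ac → ⊥-elim (noArc a c ac))
  ; certificate = record
    { parent = λ _ → nothing
    ; fromParent = λ _ → tt
    ; edgeToParent = λ a b a~b → ⊥-elim (Sum.[ noArc a b , noArc b a ] (adj-cases D a~b)) } }

module Extension {n : ℕ} (D : Digraph n) (K : ℕ)
  (out≤K : ∀ a → outdeg D a ≤ K) (in≤K : ∀ a → indeg D a ≤ K)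
  (v u : Fin n) (v~u : Adj D v u) (onlyU : ∀ w → Adj D v w → w ≡ u)
  (old : GoodColouring (delete D v) (suc K)) where

  open Deletion D v
  open GoodColouring old renaming (colour to γ′; proper to proper′)
  open ParentCertificate certificate
    renaming (parent to parent′; fromParent to fromParent′; edgeToParent to edgeToParent′)

  D′ : Digraph n
  D′ = delete D v

  u≢v : u ≢ v
  u≢v u≡v = ¬adj-self D v (subst (Adj D v) u≡v v~u)

  -- An arc u→v (resp. v→u) was lost at u, so u has room for one more out-
  -- (resp. in-) colour besides those of D′.
  roomOut : Arc D u v → suc (length (outColours D′ γ′ u)) ≤ K
  roomOut uv = begin
    suc (length (outColours D′ γ′ u)) ≡⟨ cong suc (length-outColours D′ γ′ u) ⟩
    suc (outdeg D′ u)                 ≤⟨ outdeg-delete uv ⟩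
    outdeg D u                        ≤⟨ out≤K u ⟩
    K                                 ∎
    where open ≤-Reasoning

  roomIn : Arc D v u → suc (length (inColours D′ γ′ u)) ≤ K
  roomIn vu = begin
    suc (length (inColours D′ γ′ u)) ≡⟨ cong suc (length-inColours D′ γ′ u) ⟩
    suc (indeg D′ u)                 ≤⟨ indeg-delete vu ⟩
    indeg D u                        ≤⟨ in≤K u ⟩
    K                                ∎
    where open ≤-Reasoning

  -- To keep u distinguished from its parent, the new arc at u on the side of
  -- the separating colour must avoid that colour.
  requirement : ∀ {m} → DistinguishedFrom D′ γ′ u m → Requirement (Fin (suc K))
  requirement {nothing} _             = free
  requirement {just p}  (viaOut pu _) = avoidOnOut (γ′ p u pu)
  requirement {just p}  (viaIn up _)  = avoidOnIn (γ′ u p up)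

  open ColourPair (pickTwo (T? (arc D u v)) (T? (arc D v u)) (outColours D′ γ′ u) (inColours D′ γ′ u)
                           (requirement (fromParent′ u)) roomOut roomIn)
    renaming (colA to colourUV; colB to colourVU; colA∉ to colourUV∉; colB∉ to colourVU∉;
              colA≢colB to colourUV≢colourVU)

  colourUV-fresh : Arc D u v → ∀ {w} (uw : Arc D′ u w) → colourUV ≢ γ′ u w uw
  colourUV-fresh uv uw c≡ = colourUV∉ uv (subst (_∈ outColours D′ γ′ u) (sym c≡) (∈-outColours D′ γ′ uw))

  colourVU-fresh : Arc D v u → ∀ {w} (wu : Arc D′ w u) → colourVU ≢ γ′ w u wu
  colourVU-fresh vu wu c≡ = colourVU∉ vu (subst (_∈ inColours D′ γ′ u) (sym c≡) (∈-inColours D′ γ′ wu))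

  data ArcView (a b : Fin n) : Set where
    leafOut : a ≡ v → b ≡ u → Arc D v u → ArcView a b
    leafIn  : a ≡ u → b ≡ v → Arc D u v → ArcView a b
    kept    : Arc D′ a b → ArcView a b

  view : ∀ {a b} → Arc D a b → ArcView a b
  view {a} {b} ab with a ≟ v | b ≟ v
  ... | yes a≡v | _       = leafOut a≡v b≡u (subst₂ (Arc D) a≡v b≡u ab)
    where
    b≡u : b ≡ u
    b≡u = onlyU b (subst (λ x → Adj D x b) a≡v (arc⇒adj D ab))
  ... | no _    | yes b≡v = leafIn a≡u b≡v (subst₂ (Arc D) a≡u b≡v ab)
    where
    a≡u : a ≡ u
    a≡u = onlyU a (adj-sym D (subst (Adj D a) b≡v (arc⇒adj D ab)))
  ... | no a≢v  | no b≢v  = kept (arc⇒kept ab a≢v b≢v)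

  colourOf : ∀ {a b} → ArcView a b → Fin (suc K)
  colourOf (leafOut _ _ _) = colourVU
  colourOf (leafIn _ _ _)  = colourUV
  colourOf (kept ab)       = γ′ _ _ ab

  γ : ArcColouring D (suc K)
  γ a b ab = colourOf (view ab)

  γ-kept : ∀ {a b} (ab : Arc D a b) (ab′ : Arc D′ a b) → γ a b ab ≡ γ′ a b ab′
  γ-kept ab ab′ with view ab
  ... | leafOut a≡v _ _ = ⊥-elim (proj₁ (kept⇒≢ ab′) a≡v)
  ... | leafIn _ b≡v _  = ⊥-elim (proj₂ (kept⇒≢ ab′) b≡v)
  ... | kept ab″        = cong (γ′ _ _) (T-irrelevant ab″ ab′)

  -- γ is proper: the new colours avoid the old ones at u and each other
  outColoursDiffer : ∀ {a b c} (x : ArcView a b) (y : ArcView a c) → b ≢ c → colourOf x ≢ colourOf y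
  outColoursDiffer (leafOut _ b≡u _) (leafOut _ c≡u _) b≢c = ⊥-elim (b≢c (trans b≡u (sym c≡u)))
  outColoursDiffer (leafOut a≡v _ _) (leafIn a≡u _ _)  _   = ⊥-elim (u≢v (trans (sym a≡u) a≡v))
  outColoursDiffer (leafOut a≡v _ _) (kept ac)         _   = ⊥-elim (proj₁ (kept⇒≢ ac) a≡v)
  outColoursDiffer (leafIn a≡u _ _)  (leafOut a≡v _ _) _   = ⊥-elim (u≢v (trans (sym a≡u) a≡v))
  outColoursDiffer (leafIn _ b≡v _)  (leafIn _ c≡v _)  b≢c = ⊥-elim (b≢c (trans b≡v (sym c≡v)))
  outColoursDiffer (leafIn refl _ uv) (kept uc)        _   = colourUV-fresh uv uc
  outColoursDiffer (kept ab)         (leafOut a≡v _ _) _   = ⊥-elim (proj₁ (kept⇒≢ ab) a≡v)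
  outColoursDiffer (kept ub)         (leafIn refl _ uv) _  = colourUV-fresh uv ub ∘ sym
  outColoursDiffer (kept ab)         (kept ac)         b≢c = proj₁ proper′ _ _ _ ab ac b≢c

  inColoursDiffer : ∀ {a b c} (x : ArcView a c) (y : ArcView b c) → a ≢ b → colourOf x ≢ colourOf y
  inColoursDiffer (leafOut a≡v _ _) (leafOut b≡v _ _) a≢b = ⊥-elim (a≢b (trans a≡v (sym b≡v)))
  inColoursDiffer (leafOut _ c≡u _) (leafIn _ c≡v _)  _   = ⊥-elim (u≢v (trans (sym c≡u) c≡v))
  inColoursDiffer (leafOut _ refl vu) (kept bu)       _   = colourVU-fresh vu bu
  inColoursDiffer (leafIn _ c≡v _)  (leafOut _ c≡u _) _   = ⊥-elim (u≢v (trans (sym c≡u) c≡v))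
  inColoursDiffer (leafIn a≡u _ _)  (leafIn b≡u _ _)  a≢b = ⊥-elim (a≢b (trans a≡u (sym b≡u)))
  inColoursDiffer (leafIn _ c≡v _)  (kept bc)         _   = ⊥-elim (proj₂ (kept⇒≢ bc) c≡v)
  inColoursDiffer (kept au)         (leafOut _ refl vu) _ = colourVU-fresh vu au ∘ sym
  inColoursDiffer (kept ac)         (leafIn _ c≡v _)  _   = ⊥-elim (proj₂ (kept⇒≢ ac) c≡v)
  inColoursDiffer (kept ac)         (kept bc)         a≢b = proj₂ proper′ _ _ _ ac bc a≢b

  proper : Proper D γ
  proper = (λ _ _ _ ab ac → outColoursDiffer (view ab) (view ac))
         , (λ _ _ _ ac bc → inColoursDiffer (view ac) (view bc))

  γ-fromLeaf : ∀ {a b} (ab : Arc D a b) → a ≡ v → γ a b ab ≡ colourVU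
  γ-fromLeaf ab a≡v with view ab
  ... | leafOut _ _ _  = refl
  ... | leafIn a≡u _ _ = ⊥-elim (u≢v (trans (sym a≡u) a≡v))
  ... | kept ab′       = ⊥-elim (proj₁ (kept⇒≢ ab′) a≡v)

  γ-toLeaf : ∀ {a b} (ab : Arc D a b) → b ≡ v → γ a b ab ≡ colourUV
  γ-toLeaf ab b≡v with view ab
  ... | leafOut _ b≡u _ = ⊥-elim (u≢v (trans (sym b≡u) b≡v))
  ... | leafIn _ _ _    = refl
  ... | kept ab′        = ⊥-elim (proj₂ (kept⇒≢ ab′) b≡v)

  parent : Fin n → Maybe (Fin n)
  parent c with c ≟ v
  ... | yes _ = just u
  ... | no _  = parent′ c

  -- v is separated from u by the arc u→v if present (its colour differs from
  -- colourVU, the only possible out-colour of v), and otherwise by the arc v→u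
  -- (v then has no in-arcs).
  leafDistinguished : Distinguished D γ v u
  leafDistinguished with T? (arc D u v)
  ... | yes uv = viaOut uv separated
    where
    separated : ∀ w (vw : Arc D v w) → γ v w vw ≢ γ u v uv
    separated w vw γ≡ = colourUV≢colourVU uv (subst (Arc D v) (onlyU w (arc⇒adj D vw)) vw) (begin
      colourUV ≡⟨ sym (γ-toLeaf uv refl) ⟩
      γ u v uv ≡⟨ sym γ≡ ⟩
      γ v w vw ≡⟨ γ-fromLeaf vw refl ⟩
      colourVU ∎)
      where open ≡-Reasoning
  ... | no ¬uv = viaIn vu (λ w wv _ → ¬uv (subst (λ x → Arc D x v) (onlyU w (adj-sym D (arc⇒adj D wv))) wv))
    where
    vu : Arc D v u
    vu = Sum.[ (λ vu → vu) , (λ uv → contradiction uv ¬uv) ] (adj-cases D v~u)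

  -- u keeps the separating colour from its parent thanks to the requirement
  hubDistinguished : ∀ {m} (d : DistinguishedFrom D′ γ′ u m) →
                     Respects (Arc D u v) (Arc D v u) (requirement d) colourUV colourVU →
                     DistinguishedFrom D γ u m
  hubDistinguished {nothing} _ _ = tt
  hubDistinguished {just p} (viaOut pu separated′) avoids = viaOut (delete-⊑ pu) separated
    where
    separated : ∀ w (uw : Arc D u w) → γ u w uw ≢ γ p u (delete-⊑ pu)
    separated w uw with view uw
    ... | leafOut u≡v _ _ = ⊥-elim (u≢v u≡v)
    ... | leafIn _ _ uv   = λ γ≡ → avoids uv (trans γ≡ (γ-kept _ pu))
    ... | kept uw′        = λ γ≡ → separated′ w uw′ (trans γ≡ (γ-kept _ pu))
  hubDistinguished {just p} (viaIn up separated′) avoids = viaIn (delete-⊑ up) separated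
    where
    separated : ∀ w (wu : Arc D w u) → γ w u wu ≢ γ u p (delete-⊑ up)
    separated w wu with view wu
    ... | leafOut _ _ vu  = λ γ≡ → avoids vu (trans γ≡ (γ-kept _ up))
    ... | leafIn _ u≡v _  = ⊥-elim (u≢v u≡v)
    ... | kept wu′        = λ γ≡ → separated′ w wu′ (trans γ≡ (γ-kept _ up))

  -- the arcs at a vertex other than u and v are unchanged
  keptDistinguished : ∀ {c} → c ≢ v → c ≢ u → ∀ {m} → DistinguishedFrom D′ γ′ c m → DistinguishedFrom D γ c m
  keptDistinguished c≢v c≢u {nothing} _ = tt
  keptDistinguished {c} c≢v c≢u {just p} (viaOut pc separated′) = viaOut (delete-⊑ pc) separated
    where
    separated : ∀ w (cw : Arc D c w) → γ c w cw ≢ γ p c (delete-⊑ pc)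
    separated w cw with view cw
    ... | leafOut c≡v _ _ = ⊥-elim (c≢v c≡v)
    ... | leafIn c≡u _ _  = ⊥-elim (c≢u c≡u)
    ... | kept cw′        = λ γ≡ → separated′ w cw′ (trans γ≡ (γ-kept _ pc))
  keptDistinguished {c} c≢v c≢u {just p} (viaIn cp separated′) = viaIn (delete-⊑ cp) separated
    where
    separated : ∀ w (wc : Arc D w c) → γ w c wc ≢ γ c p (delete-⊑ cp)
    separated w wc with view wc
    ... | leafOut _ c≡u _ = ⊥-elim (c≢u c≡u)
    ... | leafIn _ c≡v _  = ⊥-elim (c≢v c≡v)
    ... | kept wc′        = λ γ≡ → separated′ w wc′ (trans γ≡ (γ-kept _ cp))

  fromParent : ∀ c → DistinguishedFrom D γ c (parent c)
  fromParent c with c ≟ v | c ≟ u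
  ... | yes refl | _        = leafDistinguished
  ... | no _     | yes refl = hubDistinguished (fromParent′ u) respects
  ... | no c≢v   | no c≢u   = keptDistinguished c≢v c≢u (fromParent′ c)

  edgeToParent : ∀ a b → Adj D a b → parent a ≡ just b ⊎ parent b ≡ just a
  edgeToParent a b a~b with a ≟ v | b ≟ v
  ... | yes refl | _        = inj₁ (cong just (sym (onlyU b a~b)))
  ... | no _     | yes refl = inj₂ (cong just (sym (onlyU a (adj-sym D a~b))))
  ... | no a≢v   | no b≢v   = edgeToParent′ a b (adj⇒kept a~b a≢v b≢v)

  colouring : GoodColouring D (suc K)
  colouring = record
    { colour = γ ; proper = proper
    ; certificate = record { parent = parent ; fromParent = fromParent ; edgeToParent = edgeToParent } }

forestColouring : ∀ {n} (D : Digraph n) (K : ℕ) → Acyclic D →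
                  (∀ a → outdeg D a ≤ K) → (∀ a → indeg D a ≤ K) →
                  Acc _<_ (arcCount D) → GoodColouring D (suc K)
forestColouring D K acyclic out≤K in≤K (acc smaller)
  with any? (λ a → any? (λ b → T? (arc D a b)))
... | no noArc = arclessColouring D (λ a b ab → noArc (a , b , ab))
... | yes (_ , _ , ab) =
  Extension.colouring D K out≤K in≤K vertex neighbour adjacent onlyNeighbour
    (forestColouring (delete D vertex) K (acyclic-delete acyclic)
       (λ a → ≤-trans (outdeg-delete-≤ a) (out≤K a)) (λ a → ≤-trans (indeg-delete-≤ a) (in≤K a))
       (smaller (arcCount-delete adjacent)))
  where
  open PendantVertex (pendantVertex D acyclic ab)
  open Deletion D vertex

theorem9 : (n : ℕ) (D : Digraph n) → UnderlyingTree D → ndi≤ D (suc (Δ* D))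
theorem9 n D (_ , acyclic) = suc (Δ* D) , ≤-refl , colour , proper , certificate⇒nd D colour certificate
  where
  open GoodColouring (forestColouring D (Δ* D) acyclic (outdeg≤Δ* D) (indeg≤Δ* D) (<-wellFounded _))
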